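{- Let $w\in S_n$, let $v\subseteq w$ be a subword of size $m$ with positions $s_1<\cdots<s_m$ and entries $t_1<\cdots<t_m$, and set $u:=\mathrm{perm}(v)$. Then $\varphi_v^w(\mathrm{bpd}(w;v))\subseteq\mathrm{mbpd}(u)$, where $\varphi_v^w(B)_{i,j}=B_{s_i,t_j}$ for $1\le i,j\le m$.
   Context: Permutations are written in one-line notation. A bumpless pipe dream (BPD) of size $n$ is a tiling of the $n\times n$ grid (rows top to bottom, columns left to right; $B_{i,j}$ is the tile in row $i$, column $j$) by six tiles: blank, cross (a vertical and a horizontal segment crossing), horizontal, vertical, r-elbow (joining south edge to east edge) and j-elbow (joining west edge to north edge), such that the segments form $n$ pipes, each moving only north and east, entering through the bottom of one column and exiting through the right end of one row, one per column and per row. A pipe entering in column $j$ and exiting in row $i$ is denoted $j\rightarrow i$; the permutation $w_B$ satisfies $w_B(i)=j$ for each pipe $j\rightarrow i$. Two pipes may share several cross tiles; $B$ is reduced if any two pipes cross at most once. A pipe $j\rightarrow i$ is removable if the tile at $(i,j)$ is an r-elbow and it is the only r-elbow in row $i$ and in column $j$; $B$ is minimal if it has no removable pipe. $\mathrm{mbpd}(u)$ denotes the set of minimal reduced BPDs with permutation $u$. A subword $v\subseteq w$ is a subsequence $w(s_1)\cdots w(s_m)$ ($s_1<\cdots<s_m$) of the one-line notation, $\mathrm{perm}(v)\in S_m$ its standardization. $\mathrm{bpd}(w;v)$ is the set of reduced BPDs $B$ with permutation $w$ whose set of removable pipes is exactly $\{w(x)\rightarrow x : x\notin\{s_1,\dots,s_m\}\}$.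 -}

module Defs where

open import Data.Nat using (ℕ; zero; suc; _<_; _≤_; _+_; _*_; _∸_; _<ᵇ_; _≡ᵇ_)
open import Data.Nat.Properties using (_<?_)
open import Data.Fin using (Fin; toℕ; fromℕ<)
import Data.Fin as F
open import Data.Bool using (Bool; true; false; if_then_else_; _∧_; _∨_)
open import Data.List using (List; []; _∷_; [_])
open import Data.Maybe using (Maybe; just; nothing)
open import Data.Product using (_×_; _,_; proj₁; proj₂; ∃)
open import Relation.Nullary using (¬_; yes; no)
open import Relation.Binary.PropositionalEquality using (_≡_; _≢_)
open import Function.Bundles using (_⇔_)
open import Data.Fin.Permutation using (Permutation′; _⟨$⟩ʳ_)

-- Tiles.  Coordinates: rows top to bottom, columns left to right,
-- 0-indexed internally (row i, column j  ~  paper's (i+1, j+1)).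

data Tile : Set where
  blank cross horiz vert relbow jelbow : Tile

hasN hasS hasE hasW : Tile → Bool
hasN cross = true
hasN vert = true
hasN jelbow = true
hasN _ = false
hasS cross = true
hasS vert = true
hasS relbow = true
hasS _ = false
hasE cross = true
hasE horiz = true
hasE relbow = true
hasE _ = false
hasW cross = true
hasW horiz = true
hasW jelbow = true
hasW _ = false

isCross : Tile → Bool
isCross cross = true
isCross _ = false

Grid : ℕ → Set
Grid n = Fin n → Fin n → Tile

at : ∀ {n} → Grid n → ℕ → ℕ → Tile
at {n} B i j with i <? n | j <? n
... | yes p | yes q = B (fromℕ< p) (fromℕ< q)
... | _     | _     = blank

-- Since pipes only move north/east, these local conditions
-- say exactly that the segments form n pipes entering through the
-- bottom of each column and exiting through the right of each row.
record IsBPD {n : ℕ} (B : Grid n) : Set where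
  field
    matchH : ∀ i j → i < n → suc j < n → hasE (at B i j) ≡ hasW (at B i (suc j))
    matchV : ∀ i j → suc i < n → j < n → hasS (at B i j) ≡ hasN (at B (suc i) j)
    leftEmpty  : ∀ i → i < n → hasW (at B i 0) ≡ false
    topEmpty   : ∀ j → j < n → hasN (at B 0 j) ≡ false
    rightFull  : ∀ i → i < n → hasE (at B i (n ∸ 1)) ≡ true
    bottomFull : ∀ j → j < n → hasS (at B (n ∸ 1) j) ≡ true

data Dir : Set where
  fromS fromW : Dir

data Out : Set where
  goN goE : Out

out : Tile → Dir → Maybe Out
out cross  fromS = just goN
out cross  fromW = just goE
out horiz  fromW = just goE
out vert   fromS = just goN
out relbow fromS = just goE
out jelbow fromW = just goN
out _      _     = nothing

-- walk fuel B i j d : the list of cells visited by the pipe that enters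
-- cell (i , j) from direction d, together with the row through whose
-- right end it exits the grid (nothing if the walk breaks down).
walk : ∀ {n} → Grid n → ℕ → ℕ → ℕ → Dir → List (ℕ × ℕ) × Maybe ℕ
walk B zero i j d = [] , nothing
walk {n} B (suc f) i j d with out (at B i j) d
... | nothing = [ (i , j) ] , nothing
... | just goN with i
...   | zero   = [ (i , j) ] , nothing
...   | suc i′ = ((i , j) ∷ proj₁ r) , proj₂ r
  where r = walk B f i′ j fromS
walk {n} B (suc f) i j d | just goE =
  if suc j <ᵇ n
  then ((i , j) ∷ proj₁ r) , proj₂ r
  else ([ (i , j) ] , just i)
  where r = walk B f i (suc j) fromW

-- the pipe entering through the bottom of column j (2n steps suffice)
pipe : ∀ {n} → Grid n → Fin n → List (ℕ × ℕ) × Maybe ℕ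
pipe {n} B j = walk B (2 * n) (n ∸ 1) (toℕ j) fromS

path : ∀ {n} → Grid n → Fin n → List (ℕ × ℕ)
path B j = proj₁ (pipe B j)

exitRow : ∀ {n} → Grid n → Fin n → Maybe ℕ
exitRow B j = proj₂ (pipe B j)

-- w_B = w : for each row i, the pipe w(i) → i exits row i.
HasPerm : ∀ {n} → Grid n → Permutation′ n → Set
HasPerm {n} B w = ∀ (i : Fin n) → exitRow B (w ⟨$⟩ʳ i) ≡ just (toℕ i)

memCell : ℕ × ℕ → List (ℕ × ℕ) → Bool
memCell c [] = false
memCell (a , b) ((x , y) ∷ cs) = ((a ≡ᵇ x) ∧ (b ≡ᵇ y)) ∨ memCell (a , b) cs

sharedCrosses : ∀ {n} → Grid n → List (ℕ × ℕ) → List (ℕ × ℕ) → ℕ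
sharedCrosses B [] qs = 0
sharedCrosses B ((i , j) ∷ ps) qs =
  (if isCross (at B i j) ∧ memCell (i , j) qs then 1 else 0) + sharedCrosses B ps qs

Reduced : ∀ {n} → Grid n → Set
Reduced {n} B = ∀ (p q : Fin n) → p ≢ q → sharedCrosses B (path B p) (path B q) ≤ 1

RBPD : ∀ {n} → Permutation′ n → Grid n → Set
RBPD w B = IsBPD B × HasPerm B w × Reduced B

Removable : ∀ {n} → Grid n → Fin n → Fin n → Set
Removable {n} B i j =
  (B i j ≡ relbow)
  × (∀ (j′ : Fin n) → B i j′ ≡ relbow → j′ ≡ j)
  × (∀ (i′ : Fin n) → B i′ j ≡ relbow → i′ ≡ i)

Minimal : ∀ {n} → Permutation′ n → Grid n → Set
Minimal {n} w B = ∀ (i : Fin n) → ¬ Removable B i (w ⟨$⟩ʳ i)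

InMbpd : ∀ {m} → Permutation′ m → Grid m → Set
InMbpd u B = RBPD u B × Minimal u B

StrictlyIncreasing : ∀ {m n} → (Fin m → Fin n) → Set
StrictlyIncreasing {m} f = ∀ (a b : Fin m) → a F.< b → f a F.< f b

-- B ∈ bpd(w; v), v the subword at positions s(0) < ... < s(m-1):
-- the removable pipes are exactly w(x) → x for x not among the positions.
InBpdSub : ∀ {n m} → Permutation′ n → (Fin m → Fin n) → Grid n → Set
InBpdSub {n} {m} w s B =
  RBPD w B
  × (∀ (x : Fin n) → Removable B x (w ⟨$⟩ʳ x) ⇔ (¬ ∃ λ (k : Fin m) → s k ≡ x))

φ : ∀ {n m} → (Fin m → Fin n) → (Fin m → Fin n) → Grid n → Grid m
φ s t B i j = B (s i) (t j)

-- Every pipe w(x) → x of B with x off the subword is removable, so its r-elbow is the only one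
-- in its row and in its column; since a j-elbow would have to lie between two r-elbows, all other
-- tiles of that row and column are straight (blank, cross, horizontal or vertical). Hence every
-- tile of B in a row of s but a column outside t, or in a column of t but a row outside s, lets
-- pipes pass straight through, and deleting the rows and columns outside s and t keeps the pipe
-- structure: φ(B) is a BPD whose pipes are those of B with the deleted cells removed. So its
-- permutation is u, two of its pipes share no more crosses than in B, and a removable pipe of φ(B)
-- would lift to the pipe w(sᵢ) → sᵢ of B, which is not removable because sᵢ is a position of v.

module Submission where

open import Defs
open import Data.Bool using (Bool; true; false; _∧_; if_then_else_)
import Data.Bool as Bool
open import Data.Bool.Properties using (∨-zeroʳ; T-≡; T-∧)
open import Data.Empty using (⊥)
open import Data.Fin using (Fin; toℕ; fromℕ; fromℕ<; inject₁) renaming (zero to fzero; suc to fsuc)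
open import Data.Fin.Properties
  using (toℕ-injective; toℕ<n; fromℕ<-toℕ; toℕ-fromℕ; toℕ-fromℕ<; fromℕ<-cong; toℕ-inject₁; any?)
open import Data.Fin.Permutation using (Permutation′; _⟨$⟩ʳ_; _⟨$⟩ˡ_; inverseʳ)
open import Data.List using (List; []; _∷_; [_]; mapMaybe)
open import Data.Maybe using (Maybe; just; nothing)
open import Data.Maybe.Properties using (just-injective)
import Data.Maybe as Maybe
open import Data.Nat
  using (ℕ; zero; suc; _+_; _*_; _∸_; _≤_; _<_; z≤n; s≤s; s≤s⁻¹; z<s; _<ᵇ_; _≡ᵇ_; _<?_)
open import Data.Nat.Properties
open import Data.Product using (∃; ∃₂; _×_; _,_; proj₁; proj₂; map₁)
open import Data.Product.Properties using (,-injectiveˡ; ,-injectiveʳ)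
open import Data.Sum using (_⊎_; inj₁; inj₂)
open import Function using (_∘_)
open import Function.Bundles using (Equivalence; Injection; _⇔_)
open import Function.Properties.Inverse using (↔⇒↣)
open import Relation.Nullary using (¬_; Dec; yes; no; contradiction)
open import Relation.Nullary.Decidable using (dec⇒maybe)
open import Relation.Binary.Definitions using (tri<; tri≈; tri>)
open import Relation.Binary.PropositionalEquality hiding ([_])

infixr 5 _◂_

_◂_ : ℕ × ℕ → List (ℕ × ℕ) × Maybe ℕ → List (ℕ × ℕ) × Maybe ℕ
c ◂ r = (c ∷ proj₁ r) , proj₂ r

no-exit : ∀ {r : List (ℕ × ℕ) × Maybe ℕ} {ps x} → r ≡ (ps , nothing) → proj₂ r ≢ just x
no-exit refl ()

exit-◂ : ∀ {r r′ c x} → r ≡ c ◂ r′ → proj₂ r ≡ just x → proj₂ r′ ≡ just x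
exit-◂ refl exit = exit

module _ {N : ℕ} (G : Grid N) where

  walk-blocked : ∀ f i j d → out (at G i j) d ≡ nothing → walk G (suc f) i j d ≡ ([ (i , j) ] , nothing)
  walk-blocked f i j d o rewrite o = refl

  walk-top : ∀ f j d → out (at G 0 j) d ≡ just goN → walk G (suc f) 0 j d ≡ ([ (0 , j) ] , nothing)
  walk-top f j d o rewrite o = refl

  walk-north : ∀ f i j d → out (at G (suc i) j) d ≡ just goN →
    walk G (suc f) (suc i) j d ≡ (suc i , j) ◂ walk G f i j fromS
  walk-north f i j d o rewrite o = refl

  walk-east : ∀ f i j d → out (at G i j) d ≡ just goE → suc j < N →
    walk G (suc f) i j d ≡ (i , j) ◂ walk G f i (suc j) fromW
  walk-east f i j d o j+1<N rewrite o | Equivalence.to T-≡ (<⇒<ᵇ j+1<N) = refl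

  walk-exit : ∀ f i j d → out (at G i j) d ≡ just goE → ¬ suc j < N →
    walk G (suc f) i j d ≡ ([ (i , j) ] , just i)
  walk-exit f i j d o j+1≮N rewrite o with suc j <ᵇ N in lt
  ... | true  = contradiction (<ᵇ⇒< (suc j) N (subst Bool.T (sym lt) _)) j+1≮N
  ... | false = refl

  walk-enough-fuel : ∀ f f′ i j d {x} → j < N → proj₂ (walk G f i j d) ≡ just x →
    i + (N ∸ j) ≤ f′ → walk G f′ i j d ≡ walk G f i j d
  walk-enough-fuel zero f′ i j d j<N () enough
  walk-enough-fuel (suc f) zero i j d j<N exits enough =
    contradiction enough (<⇒≱ (<-≤-trans (m<n⇒0<n∸m j<N) (m≤n+m (N ∸ j) i)))
  walk-enough-fuel (suc f) (suc f′) i j d j<N exits enough with out (at G i j) d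
  ... | nothing = refl
  ... | just goN with i
  ...   | zero   = refl
  ...   | suc i′ = cong ((suc i′ , j) ◂_) (walk-enough-fuel f f′ i′ j fromS j<N exits (s≤s⁻¹ enough))
  walk-enough-fuel (suc f) (suc f′) i j d j<N exits enough | just goE with suc j <ᵇ N in lt
  ... | false = refl
  ... | true  = cong ((i , j) ◂_) (walk-enough-fuel f f′ i (suc j) fromW j+1<N exits enough′)
    where
    j+1<N : suc j < N
    j+1<N = <ᵇ⇒< (suc j) N (subst Bool.T (sym lt) _)
    enough′ : i + (N ∸ suc j) ≤ f′
    enough′ = s≤s⁻¹ (<-≤-trans (+-monoʳ-< i (∸-monoʳ-< (n<1+n j) (<⇒≤ j+1<N))) enough)

  at-fromℕ< : ∀ {a b} (a<N : a < N) (b<N : b < N) → at G a b ≡ G (fromℕ< a<N) (fromℕ< b<N)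
  at-fromℕ< {a} {b} a<N b<N with a <? N | b <? N
  ... | yes p | yes q = cong₂ G (fromℕ<-cong a a refl p a<N) (fromℕ<-cong b b refl q b<N)
  ... | no ¬p | _     = contradiction a<N ¬p
  ... | yes _ | no ¬q = contradiction b<N ¬q

  at-row : ∀ (a : Fin N) {k} (k<N : k < N) → at G (toℕ a) k ≡ G a (fromℕ< k<N)
  at-row a k<N = trans (at-fromℕ< (toℕ<n a) k<N) (cong (λ x → G x _) (fromℕ<-toℕ a _))

  at-column : ∀ (b : Fin N) {k} (k<N : k < N) → at G k (toℕ b) ≡ G (fromℕ< k<N) b
  at-column b k<N = trans (at-fromℕ< k<N (toℕ<n b)) (cong (G _) (fromℕ<-toℕ b _))

  at-toℕ : ∀ (a b : Fin N) → at G (toℕ a) (toℕ b) ≡ G a b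
  at-toℕ a b = trans (at-row a (toℕ<n b)) (cong (G a) (fromℕ<-toℕ b _))

data Straight : Tile → Set where
  blank : Straight blank
  cross : Straight cross
  horiz : Straight horiz
  vert  : Straight vert

straight : ∀ τ → τ ≢ relbow → τ ≢ jelbow → Straight τ
straight blank  _      _      = blank
straight cross  _      _      = cross
straight horiz  _      _      = horiz
straight vert   _      _      = vert
straight relbow ≢relbow _     = contradiction refl ≢relbow
straight jelbow _      ≢jelbow = contradiction refl ≢jelbow

Straight-hasW≡hasE : ∀ {τ} → Straight τ → hasW τ ≡ hasE τ
Straight-hasW≡hasE blank = refl
Straight-hasW≡hasE cross = refl
Straight-hasW≡hasE horiz = refl
Straight-hasW≡hasE vert  = refl

Straight-hasN≡hasS : ∀ {τ} → Straight τ → hasN τ ≡ hasS τ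
Straight-hasN≡hasS blank = refl
Straight-hasN≡hasS cross = refl
Straight-hasN≡hasS horiz = refl
Straight-hasN≡hasS vert  = refl

Straight-out-fromS : ∀ {τ} → Straight τ → out τ fromS ≡ just goN ⊎ out τ fromS ≡ nothing
Straight-out-fromS blank = inj₂ refl
Straight-out-fromS cross = inj₁ refl
Straight-out-fromS horiz = inj₂ refl
Straight-out-fromS vert  = inj₁ refl

Straight-out-fromW : ∀ {τ} → Straight τ → out τ fromW ≡ just goE ⊎ out τ fromW ≡ nothing
Straight-out-fromW blank = inj₂ refl
Straight-out-fromW cross = inj₁ refl
Straight-out-fromW horiz = inj₁ refl
Straight-out-fromW vert  = inj₂ refl

¬Straight-relbow : ¬ Straight relbow
¬Straight-relbow ()

hasE∧¬hasW⇒relbow : ∀ τ → hasE τ ≡ true → hasW τ ≡ false → τ ≡ relbow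
hasE∧¬hasW⇒relbow relbow _ _ = refl
hasE∧¬hasW⇒relbow cross  _ ()
hasE∧¬hasW⇒relbow horiz  _ ()
hasE∧¬hasW⇒relbow blank  () _
hasE∧¬hasW⇒relbow vert   () _
hasE∧¬hasW⇒relbow jelbow () _

hasS∧¬hasN⇒relbow : ∀ τ → hasS τ ≡ true → hasN τ ≡ false → τ ≡ relbow
hasS∧¬hasN⇒relbow relbow _ _ = refl
hasS∧¬hasN⇒relbow cross  _ ()
hasS∧¬hasN⇒relbow vert   _ ()
hasS∧¬hasN⇒relbow blank  () _
hasS∧¬hasN⇒relbow horiz  () _
hasS∧¬hasN⇒relbow jelbow () _

m<n⇒pred[n]<n : ∀ {m n} → m < n → n ∸ 1 < n
m<n⇒pred[n]<n {n = suc n} _ = n<1+n n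

m<n⇒suc[pred[n]]≡n : ∀ {m n} → m < n → suc (n ∸ 1) ≡ n
m<n⇒suc[pred[n]]≡n {n = suc n} _ = refl

-- L k and R k record whether the k-th tile of a row (column) of a BPD carries a segment on
-- its west (north) and east (south) side; a source is then an r-elbow and a sink a j-elbow.
module Line (N : ℕ) (L R : ℕ → Bool) (L-first : L 0 ≡ false) (R-last : R (N ∸ 1) ≡ true)
            (R≡L-next : ∀ k → suc k < N → R k ≡ L (suc k)) where

  Source : ℕ → Set
  Source k = R k ≡ true × L k ≡ false

  source-between : ∀ lo hi → lo ≤ hi → hi < N → L lo ≡ false → R hi ≡ true →
    ∃ λ k → lo ≤ k × k ≤ hi × Source k
  source-between _ zero z≤n _ L0 R0 = 0 , z≤n , z≤n , R0 , L0
  source-between lo (suc h) lo≤h+1 h+1<N Llo Rh+1 with L (suc h) in Lh+1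
  ... | false = suc h , lo≤h+1 , ≤-refl , Rh+1 , Lh+1
  ... | true with m≤n⇒m<n∨m≡n lo≤h+1
  ...   | inj₂ refl   = contradiction (trans (sym Llo) Lh+1) λ ()
  ...   | inj₁ lo<h+1 with source-between lo h (s≤s⁻¹ lo<h+1) (<-trans (n<1+n h) h+1<N) Llo
                             (trans (R≡L-next h h+1<N) Lh+1)
  ...     | k , lo≤k , k≤h , src = k , lo≤k , m≤n⇒m≤1+n k≤h , src

  -- A sink is preceded and followed by a source.
  unique-source⇒no-sink : (∀ {k k′} → k < N → k′ < N → Source k → Source k′ → k ≡ k′) →
    ∀ b → b < N → L b ≡ true → R b ≡ false → ⊥
  unique-source⇒no-sink unique zero _ L0 _ = contradiction (trans (sym L0) L-first) λ ()
  unique-source⇒no-sink unique (suc b) b+1<N Lb+1 Rb+1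
    with source-between 0 b z≤n (<-trans (n<1+n b) b+1<N) L-first (trans (R≡L-next b b+1<N) Lb+1)
  ... | k , _ , k≤b , src with m≤n⇒m<n∨m≡n b+1<N
  ...   | inj₂ refl = contradiction (trans (sym Rb+1) R-last) λ ()
  ...   | inj₁ b+2<N with source-between (suc (suc b)) (N ∸ 1) (<⇒≤pred b+2<N) (m<n⇒pred[n]<n b+1<N)
                            (trans (sym (R≡L-next (suc b) b+2<N)) Rb+1) R-last
  ...     | k′ , b+2≤k′ , k′≤last , src′ =
    <-irrefl (unique (<-trans (s≤s k≤b) b+1<N) (≤-<-trans k′≤last (m<n⇒pred[n]<n b+1<N)) src src′)
             (<-trans (s≤s k≤b) (<-≤-trans (n<1+n (suc b)) b+2≤k′))

  transport : ∀ {c c′} → c < c′ → c′ < N → (∀ k → c < k → k < c′ → L k ≡ R k) → R c ≡ L c′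
  transport {c} {suc c′} c<c′+1 c′+1<N clear with m≤n⇒m<n∨m≡n (s≤s⁻¹ c<c′+1)
  ... | inj₂ refl = R≡L-next c c′+1<N
  ... | inj₁ c<c′ = begin
    R c        ≡⟨ transport c<c′ (<-trans (n<1+n c′) c′+1<N)
                                (λ k c<k k<c′ → clear k c<k (m<n⇒m<1+n k<c′)) ⟩
    L c′       ≡⟨ clear c′ c<c′ (n<1+n c′) ⟩
    R c′       ≡⟨ R≡L-next c′ c′+1<N ⟩
    L (suc c′) ∎
    where open ≡-Reasoning

  L≡false : ∀ q → q < N → (∀ k → k < q → L k ≡ R k) → L q ≡ false
  L≡false zero    _      _     = L-first
  L≡false (suc q) q+1<N clear = begin
    L (suc q) ≡⟨ sym (transport z<s q+1<N (λ k _ k<q+1 → clear k k<q+1)) ⟩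
    R 0       ≡⟨ sym (clear 0 z<s) ⟩
    L 0       ≡⟨ L-first ⟩
    false     ∎
    where open ≡-Reasoning

  R≡true : ∀ p → p < N → (∀ k → p < k → k < N → L k ≡ R k) → R p ≡ true
  R≡true p p<N clear with m≤n⇒m<n∨m≡n (<⇒≤pred p<N)
  ... | inj₂ refl   = R-last
  ... | inj₁ p<last = begin
    R p       ≡⟨ transport p<last last<N (λ k p<k k<last → clear k p<k (<-trans k<last last<N)) ⟩
    L (N ∸ 1) ≡⟨ clear (N ∸ 1) p<last last<N ⟩
    R (N ∸ 1) ≡⟨ R-last ⟩
    true      ∎
    where
    open ≡-Reasoning
    last<N : N ∸ 1 < N
    last<N = m<n⇒pred[n]<n p<N

module BPDLines {N : ℕ} {B : Grid N} (bpd : IsBPD B) where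
  open IsBPD bpd

  module Row {a} (a<N : a < N) =
    Line N (λ k → hasW (at B a k)) (λ k → hasE (at B a k)) (leftEmpty a a<N) (rightFull a a<N)
         (λ k → matchH a k a<N)

  module Column {b} (b<N : b < N) =
    Line N (λ k → hasN (at B k b)) (λ k → hasS (at B k b)) (topEmpty b b<N) (bottomFull b b<N)
         (λ k k+1<N → matchV k b k+1<N b<N)

  straight-off-only-relbow-of-row : ∀ (x c : Fin N) → (∀ j′ → B x j′ ≡ relbow → j′ ≡ c) →
    ∀ b → b < N → b ≢ toℕ c → Straight (at B (toℕ x) b)
  straight-off-only-relbow-of-row x c only b b<N b≢c = straight _ (b≢c ∘ only-at b b<N) ¬jelbow
    where
    open Row (toℕ<n x)
    only-at : ∀ k → k < N → at B (toℕ x) k ≡ relbow → k ≡ toℕ c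
    only-at k k<N is-r = trans (sym (toℕ-fromℕ< k<N))
      (cong toℕ (only _ (trans (sym (at-row B x k<N)) is-r)))
    ¬jelbow : at B (toℕ x) b ≢ jelbow
    ¬jelbow is-j = unique-source⇒no-sink
      (λ {k} {k′} k<N k′<N (Rk , Lk) (Rk′ , Lk′) →
         trans (only-at k k<N (hasE∧¬hasW⇒relbow _ Rk Lk))
               (sym (only-at k′ k′<N (hasE∧¬hasW⇒relbow _ Rk′ Lk′))))
      b b<N (cong hasW is-j) (cong hasE is-j)

  straight-off-only-relbow-of-column : ∀ (r c : Fin N) → (∀ i′ → B i′ c ≡ relbow → i′ ≡ r) →
    ∀ a → a < N → a ≢ toℕ r → Straight (at B a (toℕ c))
  straight-off-only-relbow-of-column r c only a a<N a≢r = straight _ (a≢r ∘ only-at a a<N) ¬jelbow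
    where
    open Column (toℕ<n c)
    only-at : ∀ k → k < N → at B k (toℕ c) ≡ relbow → k ≡ toℕ r
    only-at k k<N is-r = trans (sym (toℕ-fromℕ< k<N))
      (cong toℕ (only _ (trans (sym (at-column B c k<N)) is-r)))
    ¬jelbow : at B a (toℕ c) ≢ jelbow
    ¬jelbow is-j = unique-source⇒no-sink
      (λ {k} {k′} k<N k′<N (Sk , Nk) (Sk′ , Nk′) →
         trans (only-at k k<N (hasS∧¬hasN⇒relbow _ Sk Nk))
               (sym (only-at k′ k′<N (hasS∧¬hasN⇒relbow _ Sk′ Nk′))))
      a a<N (cong hasN is-j) (cong hasS is-j)

first⊎has-predecessor : ∀ {m} (i : Fin m) → toℕ i ≡ 0 ⊎ ∃ λ (i′ : Fin m) → suc (toℕ i′) ≡ toℕ i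
first⊎has-predecessor fzero    = inj₁ refl
first⊎has-predecessor (fsuc i) = inj₂ (inject₁ i , cong suc (toℕ-inject₁ i))

last⊎has-successor : ∀ {m} (j : Fin m) → suc (toℕ j) ≡ m ⊎ ∃ λ (j′ : Fin m) → suc (toℕ j) ≡ toℕ j′
last⊎has-successor {m} j with m≤n⇒m<n∨m≡n (toℕ<n j)
... | inj₂ j+1≡m = inj₁ j+1≡m
... | inj₁ j+1<m = inj₂ (fromℕ< j+1<m , sym (toℕ-fromℕ< j+1<m))

last-index : ∀ {m} → Fin m → ∃ λ (l : Fin m) → suc (toℕ l) ≡ m
last-index {suc m} _ = fromℕ m , cong suc (toℕ-fromℕ m)

InImage : ∀ {m n} → (Fin m → Fin n) → ℕ → Set
InImage f a = ∃ λ k → toℕ (f k) ≡ a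

inImage? : ∀ {m n} (f : Fin m → Fin n) a → Dec (InImage f a)
inImage? f a = any? (λ k → toℕ (f k) ≟ a)

preimage : ∀ {m n} → (Fin m → Fin n) → ℕ → Maybe (Fin m)
preimage f a = Maybe.map proj₁ (dec⇒maybe (inImage? f a))

preimage-just : ∀ {m n} (f : Fin m → Fin n) {a k} → preimage f a ≡ just k → toℕ (f k) ≡ a
preimage-just f {a} eq with inImage? f a
preimage-just f refl | yes (k , fk≡a) = fk≡a

module Increasing {m n : ℕ} (f : Fin m → Fin n) (f↑ : StrictlyIncreasing f) where

  reflects-< : ∀ a b → toℕ (f a) < toℕ (f b) → toℕ a < toℕ b
  reflects-< a b fa<fb with <-cmp (toℕ a) (toℕ b)
  ... | tri< a<b _ _ = a<b
  ... | tri≈ _ a≡b _ = contradiction (cong (toℕ ∘ f) (toℕ-injective a≡b)) (<⇒≢ fa<fb)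
  ... | tri> _ _ b<a = contradiction (f↑ b a b<a) (<⇒≯ fa<fb)

  injective : ∀ a b → f a ≡ f b → a ≡ b
  injective a b fa≡fb with <-cmp (toℕ a) (toℕ b)
  ... | tri< a<b _ _ = contradiction (cong toℕ fa≡fb) (<⇒≢ (f↑ a b a<b))
  ... | tri≈ _ a≡b _ = toℕ-injective a≡b
  ... | tri> _ _ b<a = contradiction (cong toℕ fa≡fb) (≢-sym (<⇒≢ (f↑ b a b<a)))

  preimage-image : ∀ k → preimage f (toℕ (f k)) ≡ just k
  preimage-image k with inImage? f (toℕ (f k))
  ... | yes (k′ , fk′≡fk) = cong just (injective k′ k (toℕ-injective fk′≡fk))
  ... | no ∉image        = contradiction (k , refl) ∉image

  preimage-outside : ∀ {a} → ¬ InImage f a → preimage f a ≡ nothing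
  preimage-outside {a} ∉image with inImage? f a
  ... | yes ∈image = contradiction ∈image ∉image
  ... | no _       = refl

  ∉-image-between : ∀ k k′ → suc (toℕ k) ≡ toℕ k′ →
    ∀ {a} → toℕ (f k) < a → a < toℕ (f k′) → ¬ InImage f a
  ∉-image-between k k′ k+1≡k′ fk<a a<fk′ (k″ , refl) =
    <⇒≱ (reflects-< k k″ fk<a) (s≤s⁻¹ (subst (toℕ k″ <_) (sym k+1≡k′) (reflects-< k″ k′ a<fk′)))

  ∉-image-below : ∀ k → toℕ k ≡ 0 → ∀ {a} → a < toℕ (f k) → ¬ InImage f a
  ∉-image-below k k≡0 a<fk (k″ , refl) = contradiction (subst (toℕ k″ <_) k≡0 (reflects-< k″ k a<fk)) λ ()

  ∉-image-above : ∀ k → suc (toℕ k) ≡ m → ∀ {a} → toℕ (f k) < a → ¬ InImage f a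
  ∉-image-above k k+1≡m fk<a (k″ , refl) =
    <⇒≱ (reflects-< k k″ fk<a) (s≤s⁻¹ (subst (toℕ k″ <_) (sym k+1≡m) (toℕ<n k″)))

memCell-here : ∀ c cs → memCell c (c ∷ cs) ≡ true
memCell-here (a , b) cs
  rewrite Equivalence.to T-≡ (≡⇒≡ᵇ a a refl) | Equivalence.to T-≡ (≡⇒≡ᵇ b b refl) = refl

memCell-there : ∀ c c′ cs → memCell c cs ≡ true → memCell c (c′ ∷ cs) ≡ true
memCell-there c c′ cs mem rewrite mem = ∨-zeroʳ _

memCell-∷⁻ : ∀ c c′ cs → memCell c (c′ ∷ cs) ≡ true → c ≡ c′ ⊎ memCell c cs ≡ true
memCell-∷⁻ (a , b) (x , y) cs mem with (a ≡ᵇ x) ∧ (b ≡ᵇ y) in eq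
... | false = inj₂ mem
... | true  = inj₁ (cong₂ _,_ (≡ᵇ⇒≡ a x (proj₁ both)) (≡ᵇ⇒≡ b y (proj₂ both)))
  where both = Equivalence.to T-∧ (Equivalence.from T-≡ eq)

module Compression {n m : ℕ} (s t : Fin m → Fin n)
  (s↑ : StrictlyIncreasing s) (t↑ : StrictlyIncreasing t) (B : Grid n)
  (straight-off-columns : ∀ i {b} → b < n → ¬ InImage t b → Straight (at B (toℕ (s i)) b))
  (straight-off-rows : ∀ j {a} → a < n → ¬ InImage s a → Straight (at B a (toℕ (t j))))
  where

  module s = Increasing s s↑
  module t = Increasing t t↑

  S T : Fin m → ℕ
  S i = toℕ (s i)
  T j = toℕ (t j)

  C : Grid m
  C = φ s t B

  restrict-cell : ℕ × ℕ → Maybe (ℕ × ℕ)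
  restrict-cell (a , b) = Maybe.zipWith (λ i j → toℕ i , toℕ j) (preimage s a) (preimage t b)

  restrict : List (ℕ × ℕ) → List (ℕ × ℕ)
  restrict = mapMaybe restrict-cell

  restrict-selected : ∀ i j ps → restrict ((S i , T j) ∷ ps) ≡ (toℕ i , toℕ j) ∷ restrict ps
  restrict-selected i j ps rewrite s.preimage-image i | t.preimage-image j = refl

  restrict-◂ : ∀ i j ps {e} →
    (toℕ i , toℕ j) ◂ (restrict ps , e) ≡ (restrict ((S i , T j) ∷ ps) , e)
  restrict-◂ i j ps = cong (_, _) (sym (restrict-selected i j ps))

  restrict-skip-row : ∀ {a} b ps → ¬ InImage s a → restrict ((a , b) ∷ ps) ≡ restrict ps
  restrict-skip-row b ps ∉image rewrite s.preimage-outside ∉image = refl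

  restrict-skip-column : ∀ a {b} ps → ¬ InImage t b → restrict ((a , b) ∷ ps) ≡ restrict ps
  restrict-skip-column a ps ∉image rewrite t.preimage-outside ∉image with preimage s a
  ... | just _  = refl
  ... | nothing = refl

  restrict-cell-just : ∀ c {d} → restrict-cell c ≡ just d →
    ∃₂ λ i j → c ≡ (S i , T j) × d ≡ (toℕ i , toℕ j)
  restrict-cell-just (a , b) eq with preimage s a in ea | preimage t b in eb
  restrict-cell-just (a , b) refl | just i | just j =
    i , j , cong₂ _,_ (sym (preimage-just s ea)) (sym (preimage-just t eb)) , refl

  -- Compresses i j d r: some walk of C from (i , j), entered from d, is the walk r of B
  -- with its unselected cells deleted.
  Compresses : ℕ → ℕ → Dir → List (ℕ × ℕ) × Maybe ℕ → Set
  Compresses i j d r =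
    ∃₂ λ f k → proj₂ r ≡ just (S k) × walk C f i j d ≡ (restrict (proj₁ r) , just (toℕ k))

  Compresses-skip-row : ∀ {i j d a} b r → ¬ InImage s a →
    Compresses i j d r → Compresses i j d ((a , b) ◂ r)
  Compresses-skip-row b r ∉image (f , k , exit , walk-C) =
    f , k , exit , trans walk-C (cong (_, just (toℕ k)) (sym (restrict-skip-row b (proj₁ r) ∉image)))

  Compresses-skip-column : ∀ {i j d b} a r → ¬ InImage t b →
    Compresses i j d r → Compresses i j d ((a , b) ◂ r)
  Compresses-skip-column a r ∉image (f , k , exit , walk-C) =
    f , k , exit , trans walk-C (cong (_, just (toℕ k)) (sym (restrict-skip-column a (proj₁ r) ∉image)))

  out-B : ∀ i j {d o} → out (B (s i) (t j)) d ≡ o → out (at B (S i) (T j)) d ≡ o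
  out-B i j {d} = trans (cong (λ τ → out τ d) (at-toℕ B (s i) (t j)))

  out-C : ∀ i j {d o} → out (B (s i) (t j)) d ≡ o → out (at C (toℕ i) (toℕ j)) d ≡ o
  out-C i j {d} = trans (cong (λ τ → out τ d) (at-toℕ C i j))

  Compresses-north : ∀ {i} {i′ : Fin m} {j d a} r → S i ≡ a → out (B (s i) (t j)) d ≡ just goN →
    suc (toℕ i′) ≡ toℕ i → Compresses (toℕ i′) (toℕ j) fromS r → Compresses (toℕ i) (toℕ j) d ((a , T j) ◂ r)
  Compresses-north {i} {i′} {j} {d} r refl o i′+1≡i (f , k , exit , walk-C) =
    suc f , k , exit , (begin
      walk C (suc f) (toℕ i) (toℕ j) d
        ≡⟨ cong (λ x → walk C (suc f) x (toℕ j) d) (sym i′+1≡i) ⟩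
      walk C (suc f) (suc (toℕ i′)) (toℕ j) d
        ≡⟨ walk-north C f (toℕ i′) (toℕ j) d
             (subst (λ x → out (at C x (toℕ j)) d ≡ just goN) (sym i′+1≡i) (out-C i j o)) ⟩
      (suc (toℕ i′) , toℕ j) ◂ walk C f (toℕ i′) (toℕ j) fromS
        ≡⟨ cong₂ _◂_ (cong (_, toℕ j) i′+1≡i) walk-C ⟩
      (toℕ i , toℕ j) ◂ (restrict (proj₁ r) , just (toℕ k))
        ≡⟨ restrict-◂ i j (proj₁ r) ⟩
      (restrict ((S i , T j) ∷ proj₁ r) , just (toℕ k)) ∎)
    where open ≡-Reasoning

  Compresses-east : ∀ {i j} {j′ : Fin m} {d} r → out (B (s i) (t j)) d ≡ just goE →
    suc (toℕ j) ≡ toℕ j′ → Compresses (toℕ i) (toℕ j′) fromW r → Compresses (toℕ i) (toℕ j) d ((S i , T j) ◂ r)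
  Compresses-east {i} {j} {j′} {d} r o j+1≡j′ (f , k , exit , walk-C) =
    suc f , k , exit , (begin
      walk C (suc f) (toℕ i) (toℕ j) d
        ≡⟨ walk-east C f (toℕ i) (toℕ j) d (out-C i j o) (subst (_< m) (sym j+1≡j′) (toℕ<n j′)) ⟩
      (toℕ i , toℕ j) ◂ walk C f (toℕ i) (suc (toℕ j)) fromW
        ≡⟨ cong (λ x → (toℕ i , toℕ j) ◂ walk C f (toℕ i) x fromW) j+1≡j′ ⟩
      (toℕ i , toℕ j) ◂ walk C f (toℕ i) (toℕ j′) fromW
        ≡⟨ cong ((toℕ i , toℕ j) ◂_) walk-C ⟩
      (toℕ i , toℕ j) ◂ (restrict (proj₁ r) , just (toℕ k))
        ≡⟨ restrict-◂ i j (proj₁ r) ⟩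
      (restrict ((S i , T j) ∷ proj₁ r) , just (toℕ k)) ∎)
    where open ≡-Reasoning

  Compresses-exit : ∀ {i j d} r → out (B (s i) (t j)) d ≡ just goE → suc (toℕ j) ≡ m →
    map₁ restrict r ≡ ([] , just (S i)) → Compresses (toℕ i) (toℕ j) d ((S i , T j) ◂ r)
  Compresses-exit {i} {j} {d} r o j+1≡m restricted =
    1 , i , cong proj₂ restricted , (begin
      walk C 1 (toℕ i) (toℕ j) d
        ≡⟨ walk-exit C 0 (toℕ i) (toℕ j) d (out-C i j o) (λ j+1<m → <-irrefl j+1≡m j+1<m) ⟩
      ([ (toℕ i , toℕ j) ] , just (toℕ i))
        ≡⟨ cong (λ ps → (toℕ i , toℕ j) ◂ (ps , just (toℕ i))) (sym (cong proj₁ restricted)) ⟩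
      (toℕ i , toℕ j) ◂ (restrict (proj₁ r) , just (toℕ i))
        ≡⟨ restrict-◂ i j (proj₁ r) ⟩
      (restrict ((S i , T j) ∷ proj₁ r) , just (toℕ i)) ∎)
    where open ≡-Reasoning

  no-exit-above-first-row : ∀ f {a} j → a < n → (∀ {r} → r ≤ a → ¬ InImage s r) →
    ∀ {x} → proj₂ (walk B f a (T j) fromS) ≢ just x
  no-exit-above-first-row zero j a<n above ()
  no-exit-above-first-row (suc f) {a} j a<n above exit
    with Straight-out-fromS (straight-off-rows j a<n (above ≤-refl))
  ... | inj₂ blocked = no-exit (walk-blocked B f a (T j) fromS blocked) exit
  no-exit-above-first-row (suc f) {zero}  j a<n above exit | inj₁ north =
    no-exit (walk-top B f (T j) fromS north) exit
  no-exit-above-first-row (suc f) {suc a} j a<n above exit | inj₁ north =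
    no-exit-above-first-row f j (<-trans (n<1+n a) a<n) (λ r≤a → above (m≤n⇒m≤1+n r≤a))
      (exit-◂ (walk-north B f a (T j) fromS north) exit)

  exit-beyond-last-column : ∀ f i {b} → b < n → (∀ {c} → b ≤ c → ¬ InImage t c) →
    ∀ {x} → proj₂ (walk B f (S i) b fromW) ≡ just x →
    map₁ restrict (walk B f (S i) b fromW) ≡ ([] , just (S i))
  exit-beyond-last-column zero i b<n beyond ()
  exit-beyond-last-column (suc f) i {b} b<n beyond exit
    with Straight-out-fromW (straight-off-columns i b<n (beyond ≤-refl))
  ... | inj₂ blocked = contradiction exit (no-exit (walk-blocked B f (S i) b fromW blocked))
  ... | inj₁ east with suc b <? n
  ...   | no b+1≮n = trans (cong (map₁ restrict) (walk-exit B f (S i) b fromW east b+1≮n))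
                           (cong (_, just (S i)) (restrict-skip-column (S i) [] (beyond ≤-refl)))
  ...   | yes b+1<n = begin
    map₁ restrict (walk B (suc f) (S i) b fromW)
      ≡⟨ cong (map₁ restrict) step ⟩
    map₁ restrict ((S i , b) ◂ rest)
      ≡⟨ cong (_, proj₂ rest) (restrict-skip-column (S i) (proj₁ rest) (beyond ≤-refl)) ⟩
    map₁ restrict rest
      ≡⟨ exit-beyond-last-column f i b+1<n (λ b+1≤c → beyond (<⇒≤ b+1≤c)) (exit-◂ step exit) ⟩
    ([] , just (S i)) ∎
    where
    open ≡-Reasoning
    rest = walk B f (S i) (suc b) fromW
    step = walk-east B f (S i) b fromW east b+1<n

  -- S i ≤ a and b ≤ T j are taken split into _<_ ⊎ _≡_ so that the calls of
  -- compress-from-selected at equal fuel happen in top-level clauses rather than in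
  -- with-functions, where the termination checker could not see that they are harmless.
  compress-north-gap : ∀ f {a} i j → S i < a ⊎ S i ≡ a → a < n →
    (∀ {r} → S i < r → r ≤ a → ¬ InImage s r) →
    ∀ {x} → proj₂ (walk B f a (T j) fromS) ≡ just x →
    Compresses (toℕ i) (toℕ j) fromS (walk B f a (T j) fromS)
  compress-east-gap : ∀ f i {b} j → b < T j ⊎ b ≡ T j →
    (∀ {c} → b ≤ c → c < T j → ¬ InImage t c) →
    ∀ {x} → proj₂ (walk B f (S i) b fromW) ≡ just x →
    Compresses (toℕ i) (toℕ j) fromW (walk B f (S i) b fromW)
  compress-from-selected : ∀ f i j d {x} → proj₂ (walk B f (S i) (T j) d) ≡ just x →
    Compresses (toℕ i) (toℕ j) d (walk B f (S i) (T j) d)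
  compress-north-from-selected : ∀ f i j d {x} → out (B (s i) (t j)) d ≡ just goN →
    proj₂ (walk B (suc f) (S i) (T j) d) ≡ just x →
    Compresses (toℕ i) (toℕ j) d (walk B (suc f) (S i) (T j) d)
  compress-north-of-selected : ∀ f i j d {a x} → S i ≡ suc a → out (B (s i) (t j)) d ≡ just goN →
    a < n → proj₂ (walk B f a (T j) fromS) ≡ just x →
    Compresses (toℕ i) (toℕ j) d ((suc a , T j) ◂ walk B f a (T j) fromS)
  compress-east-from-selected : ∀ f i j d {x} → out (B (s i) (t j)) d ≡ just goE →
    proj₂ (walk B (suc f) (S i) (T j) d) ≡ just x →
    Compresses (toℕ i) (toℕ j) d (walk B (suc f) (S i) (T j) d)

  compress-north-gap zero i j Si≤a a<n gap ()
  compress-north-gap (suc f) i j (inj₂ refl) a<n gap exit = compress-from-selected (suc f) i j fromS exit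
  compress-north-gap (suc f) i j (inj₁ Si<a@(s≤s {n = a′} Si≤a′)) a<n gap exit
    with Straight-out-fromS (straight-off-rows j a<n (gap Si<a ≤-refl))
  ... | inj₂ blocked = contradiction exit (no-exit (walk-blocked B f _ (T j) fromS blocked))
  ... | inj₁ north = subst (Compresses _ _ fromS) (sym step)
    (Compresses-skip-row (T j) (walk B f a′ (T j) fromS) (gap Si<a ≤-refl)
      (compress-north-gap f i j (m≤n⇒m<n∨m≡n Si≤a′) (<-trans (n<1+n a′) a<n)
        (λ Si<r r≤a′ → gap Si<r (m≤n⇒m≤1+n r≤a′)) (exit-◂ step exit)))
    where step = walk-north B f a′ (T j) fromS north

  compress-east-gap zero i j b≤Tj gap ()
  compress-east-gap (suc f) i j (inj₂ refl) gap exit = compress-from-selected (suc f) i j fromW exit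
  compress-east-gap (suc f) i {b} j (inj₁ b<Tj) gap exit
    with Straight-out-fromW (straight-off-columns i (<-trans b<Tj (toℕ<n (t j))) (gap ≤-refl b<Tj))
  ... | inj₂ blocked = contradiction exit (no-exit (walk-blocked B f (S i) b fromW blocked))
  ... | inj₁ east = subst (Compresses _ _ fromW) (sym step)
    (Compresses-skip-column (S i) (walk B f (S i) (suc b) fromW) (gap ≤-refl b<Tj)
      (compress-east-gap f i j (m≤n⇒m<n∨m≡n b<Tj) (λ b<c c<Tj → gap (<⇒≤ b<c) c<Tj)
        (exit-◂ step exit)))
    where step = walk-east B f (S i) b fromW east (≤-<-trans b<Tj (toℕ<n (t j)))

  compress-from-selected zero i j d ()
  compress-from-selected (suc f) i j d exit with out (B (s i) (t j)) d in o
  ... | nothing  = contradiction exit (no-exit (walk-blocked B f (S i) (T j) d (out-B i j o)))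
  ... | just goN = compress-north-from-selected f i j d o exit
  ... | just goE = compress-east-from-selected f i j d o exit

  compress-north-from-selected f i j d o exit with S i in Si≡a | out-B i j o
  ... | zero  | north = contradiction exit (no-exit (walk-top B f (T j) d north))
  ... | suc a | north = subst (Compresses _ _ d) (sym step)
    (compress-north-of-selected f i j d Si≡a o (<-trans (n<1+n a) (subst (_< n) Si≡a (toℕ<n (s i))))
      (exit-◂ step exit))
    where step = walk-north B f a (T j) d north

  compress-north-of-selected f i j d Si≡a+1 o a<n exit with first⊎has-predecessor i
  ... | inj₁ i≡0 = contradiction exit (no-exit-above-first-row f j a<n
    (λ r≤a → s.∉-image-below i i≡0 (subst (_ <_) (sym Si≡a+1) (s≤s r≤a))))
  ... | inj₂ (i′ , i′+1≡i) = Compresses-north (walk B f _ (T j) fromS) Si≡a+1 o i′+1≡i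
    (compress-north-gap f i′ j (m≤n⇒m<n∨m≡n Si′≤a) a<n
      (λ Si′<r r≤a → s.∉-image-between i′ i i′+1≡i Si′<r (subst (_ <_) (sym Si≡a+1) (s≤s r≤a)))
      exit)
    where Si′≤a = s≤s⁻¹ (subst (S i′ <_) Si≡a+1 (s↑ i′ i (≤-reflexive i′+1≡i)))

  compress-east-from-selected f i j d o exit with last⊎has-successor j
  ... | inj₂ (j′ , j+1≡j′) = subst (Compresses _ _ d) (sym step)
    (Compresses-east (walk B f (S i) (suc (T j)) fromW) o j+1≡j′
      (compress-east-gap f i j′ (m≤n⇒m<n∨m≡n Tj<Tj′) (t.∉-image-between j j′ j+1≡j′)
        (exit-◂ step exit)))
    where
    Tj<Tj′ = t↑ j j′ (≤-reflexive j+1≡j′)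
    step = walk-east B f (S i) (T j) d (out-B i j o) (≤-<-trans Tj<Tj′ (toℕ<n (t j′)))
  ... | inj₁ j+1≡m with suc (T j) <? n
  ...   | no Tj+1≮n = subst (Compresses _ _ d) (sym (walk-exit B f (S i) (T j) d (out-B i j o) Tj+1≮n))
    (Compresses-exit ([] , just (S i)) o j+1≡m refl)
  ...   | yes Tj+1<n = subst (Compresses _ _ d) (sym step)
    (Compresses-exit (walk B f (S i) (suc (T j)) fromW) o j+1≡m
      (exit-beyond-last-column f i Tj+1<n (t.∉-image-above j j+1≡m) (exit-◂ step exit)))
    where step = walk-east B f (S i) (T j) d (out-B i j o) Tj+1<n

  pipe-φ : ∀ p {x} → exitRow B (t p) ≡ just x →
    ∃ λ k → x ≡ S k × pipe C p ≡ (restrict (path B (t p)) , just (toℕ k))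
  pipe-φ p exit with last-index p
  ... | l , l+1≡m with compress-north-gap (2 * n) l p (m≤n⇒m<n∨m≡n (<⇒≤pred (toℕ<n (s l))))
                         (m<n⇒pred[n]<n (toℕ<n (s l))) (λ Sl<r _ → s.∉-image-above l l+1≡m Sl<r) exit
  ...   | f , k , exit-k , walk-C = k , just-injective (trans (sym exit) exit-k) , (begin
    walk C (2 * m) (m ∸ 1) (toℕ p) fromS
      ≡⟨ cong (λ a → walk C (2 * m) a (toℕ p) fromS) (cong (_∸ 1) (sym l+1≡m)) ⟩
    walk C (2 * m) (toℕ l) (toℕ p) fromS
      ≡⟨ walk-enough-fuel C f (2 * m) (toℕ l) (toℕ p) fromS (toℕ<n p) (cong proj₂ walk-C) enough ⟩
    walk C f (toℕ l) (toℕ p) fromS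
      ≡⟨ walk-C ⟩
    (restrict (path B (t p)) , just (toℕ k)) ∎)
    where
    open ≡-Reasoning
    enough : toℕ l + (m ∸ toℕ p) ≤ 2 * m
    enough = ≤-trans (+-mono-≤ (<⇒≤ (toℕ<n l)) (m∸n≤m m (toℕ p)))
                     (≤-reflexive (cong (m +_) (sym (+-identityʳ m))))

  restrict-cell-just-toℕ : ∀ c i j → restrict-cell c ≡ just (toℕ i , toℕ j) → c ≡ (S i , T j)
  restrict-cell-just-toℕ c i j eq with restrict-cell-just c eq
  ... | i′ , j′ , refl , ij≡i′j′ =
    cong₂ _,_ (cong S (sym (toℕ-injective (,-injectiveˡ ij≡i′j′))))
              (cong T (sym (toℕ-injective (,-injectiveʳ ij≡i′j′))))

  memCell-restrict : ∀ i j qs →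
    memCell (toℕ i , toℕ j) (restrict qs) ≡ true → memCell (S i , T j) qs ≡ true
  memCell-restrict i j (q ∷ qs) mem with restrict-cell q in eq
  ... | nothing = memCell-there _ q qs (memCell-restrict i j qs mem)
  ... | just d with memCell-∷⁻ (toℕ i , toℕ j) d (restrict qs) mem
  ...   | inj₂ mem′ = memCell-there _ q qs (memCell-restrict i j qs mem′)
  ...   | inj₁ refl = subst (λ c → memCell (S i , T j) (c ∷ qs) ≡ true)
                          (sym (restrict-cell-just-toℕ q i j eq)) (memCell-here _ qs)

  crossing-restrict : ∀ i j qs →
    (if isCross (at C (toℕ i) (toℕ j)) ∧ memCell (toℕ i , toℕ j) (restrict qs) then 1 else 0)
      ≤ (if isCross (at B (S i) (T j)) ∧ memCell (S i , T j) qs then 1 else 0)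
  crossing-restrict i j qs rewrite at-toℕ C i j | at-toℕ B (s i) (t j) with isCross (B (s i) (t j))
  ... | false = z≤n
  ... | true with memCell (toℕ i , toℕ j) (restrict qs) in mem
  ...   | false = z≤n
  ...   | true rewrite memCell-restrict i j qs mem = ≤-refl

  sharedCrosses-restrict : ∀ ps qs → sharedCrosses C (restrict ps) (restrict qs) ≤ sharedCrosses B ps qs
  sharedCrosses-restrict []       qs = z≤n
  sharedCrosses-restrict (p ∷ ps) qs with restrict-cell p in eq
  ... | nothing = ≤-trans (sharedCrosses-restrict ps qs) (m≤n+m _ _)
  ... | just d with restrict-cell-just p eq
  ...   | i , j , refl , refl = +-mono-≤ (crossing-restrict i j qs) (sharedCrosses-restrict ps qs)

  φ-Reduced : (∀ p → ∃ λ x → exitRow B (t p) ≡ just x) → Reduced B → Reduced C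
  φ-Reduced exits reduced p q p≢q with pipe-φ p (proj₂ (exits p)) | pipe-φ q (proj₂ (exits q))
  ... | _ , _ , pipe-p | _ , _ , pipe-q = begin
    sharedCrosses C (path C p) (path C q)
      ≡⟨ cong₂ (sharedCrosses C) (cong proj₁ pipe-p) (cong proj₁ pipe-q) ⟩
    sharedCrosses C (restrict (path B (t p))) (restrict (path B (t q)))
      ≤⟨ sharedCrosses-restrict (path B (t p)) (path B (t q)) ⟩
    sharedCrosses B (path B (t p)) (path B (t q))
      ≤⟨ reduced (t p) (t q) (p≢q ∘ t.injective p q) ⟩
    1 ∎
    where open ≤-Reasoning

  removable-φ : ∀ i j → Removable C i j → Removable B (s i) (t j)
  removable-φ i j (is-relbow , only-in-row , only-in-column) = is-relbow , only-in-row′ , only-in-column′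
    where
    only-in-row′ : ∀ j′ → B (s i) j′ ≡ relbow → j′ ≡ t j
    only-in-row′ j′ is-relbow′ with inImage? t (toℕ j′)
    ... | yes (k , tk≡j′) rewrite sym (toℕ-injective tk≡j′) = cong t (only-in-row k is-relbow′)
    ... | no ∉image = contradiction
      (subst Straight (trans (at-toℕ B (s i) j′) is-relbow′) (straight-off-columns i (toℕ<n j′) ∉image))
      ¬Straight-relbow
    only-in-column′ : ∀ i′ → B i′ (t j) ≡ relbow → i′ ≡ s i
    only-in-column′ i′ is-relbow′ with inImage? s (toℕ i′)
    ... | yes (k , sk≡i′) rewrite sym (toℕ-injective sk≡i′) = cong s (only-in-column k is-relbow′)
    ... | no ∉image = contradiction
      (subst Straight (trans (at-toℕ B i′ (t j)) is-relbow′) (straight-off-rows j (toℕ<n i′) ∉image))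
      ¬Straight-relbow

  module _ (bpd : IsBPD B) where
    open BPDLines bpd

    clear-in-row : ∀ i {k} → k < n → ¬ InImage t k → hasW (at B (S i) k) ≡ hasE (at B (S i) k)
    clear-in-row i k<n ∉image = Straight-hasW≡hasE (straight-off-columns i k<n ∉image)

    clear-in-column : ∀ j {k} → k < n → ¬ InImage s k → hasN (at B k (T j)) ≡ hasS (at B k (T j))
    clear-in-column j k<n ∉image = Straight-hasN≡hasS (straight-off-rows j k<n ∉image)

    hasE≡hasW-next : ∀ i j j′ → suc (toℕ j) ≡ toℕ j′ → hasE (C i j) ≡ hasW (C i j′)
    hasE≡hasW-next i j j′ j+1≡j′ = begin
      hasE (C i j)             ≡⟨ cong hasE (sym (at-toℕ B (s i) (t j))) ⟩
      hasE (at B (S i) (T j))  ≡⟨ Row.transport (toℕ<n (s i)) (t↑ j j′ (≤-reflexive j+1≡j′)) (toℕ<n (t j′)) clear ⟩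
      hasW (at B (S i) (T j′)) ≡⟨ cong hasW (at-toℕ B (s i) (t j′)) ⟩
      hasW (C i j′)            ∎
      where
      open ≡-Reasoning
      clear : ∀ k → T j < k → k < T j′ → hasW (at B (S i) k) ≡ hasE (at B (S i) k)
      clear k Tj<k k<Tj′ =
        clear-in-row i (<-trans k<Tj′ (toℕ<n (t j′))) (t.∉-image-between j j′ j+1≡j′ Tj<k k<Tj′)

    hasS≡hasN-next : ∀ i i′ j → suc (toℕ i) ≡ toℕ i′ → hasS (C i j) ≡ hasN (C i′ j)
    hasS≡hasN-next i i′ j i+1≡i′ = begin
      hasS (C i j)             ≡⟨ cong hasS (sym (at-toℕ B (s i) (t j))) ⟩
      hasS (at B (S i) (T j))  ≡⟨ Column.transport (toℕ<n (t j)) (s↑ i i′ (≤-reflexive i+1≡i′)) (toℕ<n (s i′)) clear ⟩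
      hasN (at B (S i′) (T j)) ≡⟨ cong hasN (at-toℕ B (s i′) (t j)) ⟩
      hasN (C i′ j)            ∎
      where
      open ≡-Reasoning
      clear : ∀ k → S i < k → k < S i′ → hasN (at B k (T j)) ≡ hasS (at B k (T j))
      clear k Si<k k<Si′ =
        clear-in-column j (<-trans k<Si′ (toℕ<n (s i′))) (s.∉-image-between i i′ i+1≡i′ Si<k k<Si′)

    hasW-first : ∀ i j → toℕ j ≡ 0 → hasW (C i j) ≡ false
    hasW-first i j j≡0 = trans (cong hasW (sym (at-toℕ B (s i) (t j))))
      (Row.L≡false (toℕ<n (s i)) (T j) (toℕ<n (t j))
        (λ k k<Tj → clear-in-row i (<-trans k<Tj (toℕ<n (t j))) (t.∉-image-below j j≡0 k<Tj)))

    hasN-first : ∀ i j → toℕ i ≡ 0 → hasN (C i j) ≡ false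
    hasN-first i j i≡0 = trans (cong hasN (sym (at-toℕ B (s i) (t j))))
      (Column.L≡false (toℕ<n (t j)) (S i) (toℕ<n (s i))
        (λ k k<Si → clear-in-column j (<-trans k<Si (toℕ<n (s i))) (s.∉-image-below i i≡0 k<Si)))

    hasE-last : ∀ i j → suc (toℕ j) ≡ m → hasE (C i j) ≡ true
    hasE-last i j j+1≡m = trans (cong hasE (sym (at-toℕ B (s i) (t j))))
      (Row.R≡true (toℕ<n (s i)) (T j) (toℕ<n (t j))
        (λ k Tj<k k<n → clear-in-row i k<n (t.∉-image-above j j+1≡m Tj<k)))

    hasS-last : ∀ i j → suc (toℕ i) ≡ m → hasS (C i j) ≡ true
    hasS-last i j i+1≡m = trans (cong hasS (sym (at-toℕ B (s i) (t j))))
      (Column.R≡true (toℕ<n (t j)) (S i) (toℕ<n (s i))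
        (λ k Si<k k<n → clear-in-column j k<n (s.∉-image-above i i+1≡m Si<k)))

    φ-IsBPD : IsBPD C
    φ-IsBPD = record
      { matchH     = λ i j i<m j+1<m → let j<m = <-trans (n<1+n j) j+1<m in
          trans (cong hasE (at-fromℕ< C i<m j<m))
            (trans (hasE≡hasW-next _ _ _ (trans (cong suc (toℕ-fromℕ< j<m)) (sym (toℕ-fromℕ< j+1<m))))
                   (cong hasW (sym (at-fromℕ< C i<m j+1<m))))
      ; matchV     = λ i j i+1<m j<m → let i<m = <-trans (n<1+n i) i+1<m in
          trans (cong hasS (at-fromℕ< C i<m j<m))
            (trans (hasS≡hasN-next _ _ _ (trans (cong suc (toℕ-fromℕ< i<m)) (sym (toℕ-fromℕ< i+1<m))))
                   (cong hasN (sym (at-fromℕ< C i+1<m j<m))))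
      ; leftEmpty  = λ i i<m → let 0<m = <-≤-trans z<s i<m in
          trans (cong hasW (at-fromℕ< C i<m 0<m)) (hasW-first _ _ (toℕ-fromℕ< 0<m))
      ; topEmpty   = λ j j<m → let 0<m = <-≤-trans z<s j<m in
          trans (cong hasN (at-fromℕ< C 0<m j<m)) (hasN-first _ _ (toℕ-fromℕ< 0<m))
      ; rightFull  = λ i i<m → let last<m = m<n⇒pred[n]<n i<m in
          trans (cong hasE (at-fromℕ< C i<m last<m))
            (hasE-last _ _ (trans (cong suc (toℕ-fromℕ< last<m)) (m<n⇒suc[pred[n]]≡n i<m)))
      ; bottomFull = λ j j<m → let last<m = m<n⇒pred[n]<n j<m in
          trans (cong hasS (at-fromℕ< C last<m j<m))
            (hasS-last _ _ (trans (cong suc (toℕ-fromℕ< last<m)) (m<n⇒suc[pred[n]]≡n j<m)))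
      }

module BpdOfSubword {n m : ℕ} (w : Permutation′ n) (s t : Fin m → Fin n)
  (s↑ : StrictlyIncreasing s) (t↑ : StrictlyIncreasing t) (u : Permutation′ m)
  (t∘u≡w∘s : ∀ i → t (u ⟨$⟩ʳ i) ≡ w ⟨$⟩ʳ s i) (B : Grid n)
  (isBPD : IsBPD B) (perm : HasPerm B w)
  (removable⇔ : ∀ x → Removable B x (w ⟨$⟩ʳ x) ⇔ (¬ ∃ λ k → s k ≡ x))
  where

  open BPDLines isBPD

  w-injective : ∀ {x y} → w ⟨$⟩ʳ x ≡ w ⟨$⟩ʳ y → x ≡ y
  w-injective = Injection.injective (↔⇒↣ w)

  removable : ∀ x → ¬ (∃ λ k → s k ≡ x) → Removable B x (w ⟨$⟩ʳ x)
  removable x = Equivalence.from (removable⇔ x)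

  straight-off-columns : ∀ i {b} → b < n → ¬ InImage t b → Straight (at B (toℕ (s i)) b)
  straight-off-columns i {b} b<n ∉image =
    subst (λ c → Straight (at B (toℕ (s i)) c)) (trans (cong toℕ wx≡y) (toℕ-fromℕ< b<n))
      (straight-off-only-relbow-of-column x (w ⟨$⟩ʳ x) (proj₂ (proj₂ (removable x x∉s)))
        (toℕ (s i)) (toℕ<n (s i)) (λ si≡x → x∉s (i , toℕ-injective si≡x)))
    where
    y = fromℕ< b<n
    x = w ⟨$⟩ˡ y
    wx≡y : w ⟨$⟩ʳ x ≡ y
    wx≡y = inverseʳ w
    x∉s : ¬ ∃ λ k → s k ≡ x
    x∉s (k , sk≡x) = ∉image (u ⟨$⟩ʳ k ,
      trans (cong toℕ (trans (t∘u≡w∘s k) (trans (cong (w ⟨$⟩ʳ_) sk≡x) wx≡y)))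
            (toℕ-fromℕ< b<n))

  straight-off-rows : ∀ j {a} → a < n → ¬ InImage s a → Straight (at B a (toℕ (t j)))
  straight-off-rows j {a} a<n ∉image =
    subst (λ r → Straight (at B r (toℕ (t j)))) (toℕ-fromℕ< a<n)
      (straight-off-only-relbow-of-row x (w ⟨$⟩ʳ x) (proj₁ (proj₂ (removable x x∉s)))
        (toℕ (t j)) (toℕ<n (t j))
        (λ tj≡wx → x∉s (u ⟨$⟩ˡ j , w-injective (w∘s∘u⁻¹ (toℕ-injective tj≡wx)))))
    where
    x = fromℕ< a<n
    x∉s : ¬ ∃ λ k → s k ≡ x
    x∉s (k , sk≡x) = ∉image (k , trans (cong toℕ sk≡x) (toℕ-fromℕ< a<n))
    w∘s∘u⁻¹ : t j ≡ w ⟨$⟩ʳ x → w ⟨$⟩ʳ s (u ⟨$⟩ˡ j) ≡ w ⟨$⟩ʳ x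
    w∘s∘u⁻¹ tj≡wx = trans (sym (t∘u≡w∘s (u ⟨$⟩ˡ j))) (trans (cong t (inverseʳ u)) tj≡wx)

  open Compression s t s↑ t↑ B straight-off-columns straight-off-rows public

  exits : ∀ p → ∃ λ x → exitRow B (t p) ≡ just x
  exits p = toℕ y , subst (λ c → exitRow B c ≡ just (toℕ y)) (inverseʳ w) (perm y)
    where y = w ⟨$⟩ˡ t p

  φ-HasPerm : HasPerm C u
  φ-HasPerm i
    with pipe-φ (u ⟨$⟩ʳ i) (subst (λ c → exitRow B c ≡ just (S i)) (sym (t∘u≡w∘s i)) (perm (s i)))
  ... | k , Si≡Sk , pipe-C =
    trans (cong proj₂ pipe-C) (cong (just ∘ toℕ) (s.injective k i (toℕ-injective (sym Si≡Sk))))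

  φ-Minimal : Minimal u C
  φ-Minimal i removable-C =
    Equivalence.to (removable⇔ (s i))
      (subst (Removable B (s i)) (t∘u≡w∘s i) (removable-φ i (u ⟨$⟩ʳ i) removable-C)) (i , refl)

mainTheorem3 : (n m : ℕ) (w : Permutation′ n)
    → (s t : Fin m → Fin n)
    → StrictlyIncreasing s
    → StrictlyIncreasing t
    → (u : Permutation′ m)
    → (∀ (i : Fin m) → t (u ⟨$⟩ʳ i) ≡ w ⟨$⟩ʳ s i)
    → (B : Grid n)
    → InBpdSub w s B
    → InMbpd u (φ s t B)
mainTheorem3 n m w s t s↑ t↑ u t∘u≡w∘s B ((isBPD , perm , reduced) , removable⇔) =
  (φ-IsBPD isBPD , φ-HasPerm , φ-Reduced exits reduced) , φ-Minimal
  where open BpdOfSubword w s t s↑ t↑ u t∘u≡w∘s B isBPD perm removable⇔
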